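{- Let $G$ be a simple connected graph of order $n\geq 3$, and let $V=V(G)\subseteq V(R(G))$. Then $V$ contains a minimum dominating set of $R(G)$.
   Context: $R(G)$ is the graph obtained from $G$ by adding, for each edge $e=xy\in E(G)$, a new vertex $v_e$ adjacent exactly to $x$ and $y$. A dominating set of a graph is a set $S$ of vertices such that every vertex is in $S$ or adjacent to a vertex of $S$. -}

module Defs where

open import Data.Nat using (ℕ; _≤_)
open import Data.Fin using (Fin; _<_)
open import Data.Bool using (Bool; true)
open import Data.Product using (Σ; _×_; _,_; proj₁; proj₂; ∃)
open import Data.Sum using (_⊎_; inj₁; inj₂)
open import Data.Empty using (⊥)
open import Data.List using (List; length)
open import Data.List.Relation.Unary.Any using (Any)
open import Data.List.Relation.Unary.All using (All)
open import Data.List.Relation.Unary.Unique.Propositional using (Unique)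
open import Relation.Binary.PropositionalEquality using (_≡_)
open import Relation.Nullary using (¬_)

Adjacency : ℕ → Set
Adjacency n = Fin n → Fin n → Bool

IsSimple : ∀ {n} → Adjacency n → Set
IsSimple {n} adj = (∀ x → ¬ (adj x x ≡ true)) × (∀ x y → adj x y ≡ adj y x)

data Reach {n : ℕ} (adj : Adjacency n) : Fin n → Fin n → Set where
  here : ∀ {x} → Reach adj x x
  step : ∀ {x y z} → adj x y ≡ true → Reach adj y z → Reach adj x z

IsConnected : ∀ {n} → Adjacency n → Set
IsConnected {n} adj = ∀ (x y : Fin n) → Reach adj x y

-- each edge {x,y} of G is represented once, as the ordered pair (x , y) with x < y
Edge : ∀ {n} → Adjacency n → Set
Edge {n} adj = Σ (Fin n × Fin n) λ p → (proj₁ p < proj₂ p) × (adj (proj₁ p) (proj₂ p) ≡ true)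

-- vertices of R(G): original vertices (inj₁) and a new vertex v_e per edge e (inj₂)
RVertex : ∀ {n} → Adjacency n → Set
RVertex {n} adj = Fin n ⊎ Edge adj

Endpoint : ∀ {n} {adj : Adjacency n} → Fin n → Edge adj → Set
Endpoint x ((a , b) , _) = (x ≡ a) ⊎ (x ≡ b)

RAdj : ∀ {n} (adj : Adjacency n) → RVertex adj → RVertex adj → Set
RAdj adj (inj₁ x) (inj₁ y) = adj x y ≡ true
RAdj adj (inj₁ x) (inj₂ e) = Endpoint x e
RAdj adj (inj₂ e) (inj₁ x) = Endpoint x e
RAdj adj (inj₂ e) (inj₂ f) = ⊥

-- Dominating sets of R(G), as duplicate-free lists of vertices.

IsDominatingR : ∀ {n} (adj : Adjacency n) → List (RVertex adj) → Set
IsDominatingR adj D = ∀ v → Any (λ u → (u ≡ v) ⊎ RAdj adj u v) D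

IsMinDominatingR : ∀ {n} (adj : Adjacency n) → List (RVertex adj) → Set
IsMinDominatingR adj D =
  Unique D × IsDominatingR adj D ×
  (∀ (D' : List (RVertex adj)) → Unique D' → IsDominatingR adj D' → length D ≤ length D')

IsOriginal : ∀ {n} {adj : Adjacency n} → RVertex adj → Set
IsOriginal {n} v = Σ (Fin n) λ x → v ≡ inj₁ x

-- A dominating set D of R(G) can be pushed into V(G) without growing: keep each
-- original vertex of D, and replace each subdivision vertex v_e by an endpoint of e,
-- which dominates everything v_e did. Hence among the dominating sets of minimum
-- size there is one inside V(G); it is found as a shortest dominating sublist of
-- the vertex list of G.
module Submission where

open import Defs
open import Level using (Level)
open import Data.Nat using (ℕ; suc; _≤_; z≤n; s≤s)
open import Data.Nat.Properties using (module ≤-Reasoning)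
open import Data.Product using (Σ; ∃; _×_; _,_; proj₂)
open import Data.Sum using (_⊎_; inj₁; inj₂)
open import Data.List using (List; []; _∷_; [_]; _++_; map; filter; length; allFin)
open import Data.List.Properties using (length-map; length-removeAt′)
open import Data.List.Extrema.Nat using (argmin; argmin-all; f[argmin]≤f[xs])
open import Data.List.Relation.Unary.All as All using (All)
import Data.List.Relation.Unary.All.Properties as All
open import Data.List.Relation.Unary.Any as Any using (Any; here; there; _─_)
import Data.List.Relation.Unary.Any.Properties as Any
open import Data.List.Relation.Unary.Unique.Propositional using (Unique; _∷_)
import Data.List.Relation.Unary.Unique.Propositional.Properties as Unique
open import Data.List.Relation.Unary.Unique.DecPropositional using (unique?)
open import Data.List.Membership.Propositional using (_∈_)
open import Data.List.Membership.Propositional.Properties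
  using (∈-map⁺; ∈-++⁺ˡ; ∈-++⁺ʳ; ∈-filter⁺; ∈-filter⁻; ∈-allFin)
import Data.List.Membership.DecPropositional as DecMembership
open import Data.List.Relation.Binary.Subset.Propositional using (_⊆_)
open import Data.List.Relation.Binary.Subset.Propositional.Properties using (Any-resp-⊆)
open import Data.List.Relation.Binary.Sublist.Propositional
  using ([]; _∷ʳ_; _∷_) renaming (_⊆_ to _⊑_)
open import Data.List.Relation.Binary.Sublist.Propositional.Properties using (filter-⊆)
open import Data.Fin using (Fin; _<_)
import Data.Fin.Properties as Fin
open import Data.Bool using (true)
import Data.Bool.Properties as Bool
open import Data.Empty using (⊥-elim)
open import Relation.Nullary using (_×-dec_; _→-dec_; _⊎-dec_)
open import Relation.Unary using (Pred; Decidable)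
open import Relation.Unary.Properties using (_∩?_)
open import Relation.Binary.PropositionalEquality using (_≡_; _≢_; refl)

private
  variable
    a ℓ : Level
    A : Set a
    x y : A
    xs ys : List A

∈-─⁺ : (x∈ys : x ∈ ys) → x ≢ y → y ∈ ys → y ∈ (ys ─ x∈ys)
∈-─⁺ (here refl)   x≢y (here refl)   = ⊥-elim (x≢y refl)
∈-─⁺ (here refl)   _   (there y∈ys) = y∈ys
∈-─⁺ (there _)     _   (here refl)   = here refl
∈-─⁺ (there x∈ys) x≢y (there y∈ys) = there (∈-─⁺ x∈ys x≢y y∈ys)

unique-⊆⇒length≤ : Unique xs → xs ⊆ ys → length xs ≤ length ys
unique-⊆⇒length≤ {xs = []} _ _ = z≤n
unique-⊆⇒length≤ {xs = x ∷ xs} {ys} (x∉xs ∷ unique-xs) x∷xs⊆ys = begin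
  suc (length xs)             ≤⟨ s≤s (unique-⊆⇒length≤ unique-xs xs⊆ys─x) ⟩
  suc (length (ys ─ x∈ys))    ≡⟨ length-removeAt′ ys (Any.index x∈ys) ⟨
  length ys                   ∎
  where
  open ≤-Reasoning
  x∈ys : x ∈ ys
  x∈ys = x∷xs⊆ys (here refl)
  xs⊆ys─x : xs ⊆ (ys ─ x∈ys)
  xs⊆ys─x y∈xs = ∈-─⁺ x∈ys (All.lookup x∉xs y∈xs) (x∷xs⊆ys (there y∈xs))

sublists : List A → List (List A)
sublists []       = [ [] ]
sublists (x ∷ xs) = map (x ∷_) (sublists xs) ++ sublists xs

∈-sublists : ys ⊑ xs → ys ∈ sublists xs
∈-sublists []             = here refl
∈-sublists (_ ∷ʳ ys⊑xs)   = ∈-++⁺ʳ _ (∈-sublists ys⊑xs)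
∈-sublists (refl ∷ ys⊑xs) = ∈-++⁺ˡ (∈-map⁺ _ (∈-sublists ys⊑xs))

shortest-sublist : {P : Pred (List A) ℓ} → Decidable P → P xs →
                   Σ (List A) λ m → P m × (∀ {ys} → ys ⊑ xs → P ys → length m ≤ length ys)
shortest-sublist {xs = xs} P? Pxs =
  argmin length xs candidates ,
  argmin-all length Pxs (All.all-filter P? (sublists xs)) ,
  λ ys⊑xs Pys → All.lookup (f[argmin]≤f[xs] xs candidates) (∈-filter⁺ P? (∈-sublists ys⊑xs) Pys)
  where candidates = filter P? (sublists xs)

module _ {n : ℕ} (adj : Adjacency n) where

  open DecMembership (Fin._≟_ {n}) using (_∈?_)

  -- A set of original vertices dominates R(G) iff it dominates G and covers every edge
  -- of G; the edges are quantified through their endpoints so that this is decidable.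
  DominatesR : List (Fin n) → Set
  DominatesR L =
    (∀ x → Any (λ y → (y ≡ x) ⊎ (adj y x ≡ true)) L) ×
    (∀ a b → a < b → adj a b ≡ true → Any (λ y → (y ≡ a) ⊎ (y ≡ b)) L)

  dominatesR? : Decidable DominatesR
  dominatesR? L =
    Fin.all? (λ x → Any.any? (λ y → (y Fin.≟ x) ⊎-dec (adj y x Bool.≟ true)) L) ×-dec
    Fin.all? (λ a → Fin.all? (λ b → a Fin.<? b →-dec (adj a b Bool.≟ true →-dec
      Any.any? (λ y → (y Fin.≟ a) ⊎-dec (y Fin.≟ b)) L)))

  DominatesR-resp-⊆ : ∀ {L L′} → L ⊆ L′ → DominatesR L → DominatesR L′
  DominatesR-resp-⊆ L⊆L′ (dominates , covers) =
    (λ x → Any-resp-⊆ L⊆L′ (dominates x)) ,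
    (λ a b a<b ab → Any-resp-⊆ L⊆L′ (covers a b a<b ab))

  allFin-dominatesR : DominatesR (allFin n)
  allFin-dominatesR =
    (λ x → Any.map (λ { refl → inj₁ refl }) (∈-allFin x)) ,
    (λ a _ _ _ → Any.map (λ { refl → inj₁ refl }) (∈-allFin a))

  dominatesR⇒isDominatingR : ∀ {L} → DominatesR L → IsDominatingR adj (map inj₁ L)
  dominatesR⇒isDominatingR (dominates , _) (inj₁ x) =
    Any.map⁺ (Any.map (λ { (inj₁ refl) → inj₁ refl ; (inj₂ yx) → inj₂ yx }) (dominates x))
  dominatesR⇒isDominatingR (_ , covers) (inj₂ ((a , b) , a<b , ab)) =
    Any.map⁺ (Any.map inj₂ (covers a b a<b ab))

  project : RVertex adj → Fin n
  project (inj₁ x)             = x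
  project (inj₂ ((a , _) , _)) = a

  project-dominates-vertex : ∀ u x → (u ≡ inj₁ x) ⊎ RAdj adj u (inj₁ x) →
                             (project u ≡ x) ⊎ (adj (project u) x ≡ true)
  project-dominates-vertex (inj₁ _) _ (inj₁ refl) = inj₁ refl
  project-dominates-vertex (inj₁ _) _ (inj₂ yx)   = inj₂ yx
  project-dominates-vertex (inj₂ _) _ (inj₂ (inj₁ refl)) = inj₁ refl
  project-dominates-vertex (inj₂ (_ , _ , ab)) _ (inj₂ (inj₂ refl)) = inj₂ ab

  project-dominates-edge : ∀ u (e : Edge adj) → (u ≡ inj₂ e) ⊎ RAdj adj u (inj₂ e) →
                           Endpoint (project u) e
  project-dominates-edge (inj₁ _) _ (inj₂ endpoint) = endpoint
  project-dominates-edge (inj₂ _) _ (inj₁ refl)     = inj₁ refl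

  isDominatingR⇒dominatesR : ∀ {D} → IsDominatingR adj D → DominatesR (map project D)
  isDominatingR⇒dominatesR dominating =
    (λ x → Any.map⁺ (Any.map (project-dominates-vertex _ x) (dominating (inj₁ x)))) ,
    (λ a b a<b ab → let e = ((a , b) , a<b , ab) in
      Any.map⁺ (Any.map (project-dominates-edge _ e) (dominating (inj₂ e))))

  original-dominating-≤ : ∀ {D} → IsDominatingR adj D →
                    ∃ λ S → S ⊑ allFin n × (Unique S × DominatesR S) × length S ≤ length D
  original-dominating-≤ {D} dominating =
    S , filter-⊆ (_∈? L) (allFin n) ,
    (unique-S , DominatesR-resp-⊆ L⊆S (isDominatingR⇒dominatesR dominating)) ,
    (begin
      length S  ≤⟨ unique-⊆⇒length≤ unique-S S⊆L ⟩
      length L  ≡⟨ length-map project D ⟩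
      length D  ∎)
    where
    open ≤-Reasoning
    L = map project D
    S = filter (_∈? L) (allFin n)
    unique-S : Unique S
    unique-S = Unique.filter⁺ (_∈? L) {allFin n} (Unique.allFin⁺ n)
    L⊆S : L ⊆ S
    L⊆S = ∈-filter⁺ (_∈? L) (∈-allFin _)
    S⊆L : S ⊆ L
    S⊆L x∈S = proj₂ (∈-filter⁻ (_∈? L) {xs = allFin n} x∈S)

proposition2p2 : ∀ (n : ℕ) (adj : Adjacency n) → 3 ≤ n → IsSimple adj → IsConnected adj →
    Σ (List (RVertex adj)) λ D → All IsOriginal D × IsMinDominatingR adj D
proposition2p2 n adj _ _ _
  with m , (unique-m , dominates-m) , shortest ←
       shortest-sublist (unique? Fin._≟_ ∩? dominatesR? adj) (Unique.allFin⁺ n , allFin-dominatesR adj)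
  = map inj₁ m ,
    All.map⁺ (All.tabulate λ {x} _ → x , refl) ,
    Unique.map⁺ (λ { refl → refl }) unique-m ,
    dominatesR⇒isDominatingR adj dominates-m ,
    minimal
  where
  open ≤-Reasoning
  minimal : ∀ D → Unique D → IsDominatingR adj D → length (map inj₁ m) ≤ length D
  minimal D _ dominating with S , S⊑allFin , PS , S≤D ← original-dominating-≤ adj dominating = begin
    length (map inj₁ m)  ≡⟨ length-map inj₁ m ⟩
    length m             ≤⟨ shortest S⊑allFin PS ⟩
    length S             ≤⟨ S≤D ⟩
    length D             ∎
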